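{- Let $r \geq 1$ be an integer and let $b > 1$ be an integer with $\gcd(2,b) = 1$ such that $2^r b^2$ is almost perfect. Then $b^2$ is solitary.
   Context: $\sigma(x)$ denotes the sum of the positive divisors of $x$, and $I(x) = \sigma(x)/x$ is the abundancy index. A positive integer $y$ is almost perfect if $\sigma(y) = 2y - 1$. A positive integer $S$ is solitary if the equation $I(S) = I(d)$ in positive integers $d$ has exactly one solution, namely $d = S$. -}

module Defs where

open import Data.Nat using (ℕ; zero; suc; _*_; _∸_; _≥_; NonZero)
open import Data.Nat.Divisibility using (_∣?_)
open import Data.Nat.ListAction using (sum)
open import Data.List using (List; filter; upTo; map)
open import Data.Integer using (+_)
open import Data.Rational using (ℚ; _/_)
open import Data.Product using (_×_)
open import Relation.Binary.PropositionalEquality using (_≡_)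

divisors : ℕ → List ℕ
divisors n = filter (_∣? n) (map suc (upTo n))

σ : ℕ → ℕ
σ n = sum (divisors n)

I : (x : ℕ) → .{{NonZero x}} → ℚ
I x = (+ σ x) / x

AlmostPerfect : ℕ → Set
AlmostPerfect y = (y ≥ 1) × (σ y ≡ 2 * y ∸ 1)

Solitary : (S : ℕ) → .{{NonZero S}} → Set
Solitary S = (d : ℕ) → .{{_ : NonZero d}} → I S ≡ I d → d ≡ S

module Submission where

-- Proof idea.  Write n = b², which is odd, and N = 2ʳ·n.
--
-- (1) For odd m, the divisors of 2·(2ᵏ·m) are the doubles of the divisors
--     of 2ᵏ·m together with the divisors of m; hence
--     σ(2ᵏ⁺¹·m) = 2·σ(2ᵏ·m) + σ(m), and by induction
--     σ(2ᵏ·m) + σ(m) = 2ᵏ⁺¹·σ(m).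
-- (2) If N is almost perfect, σ(N) + 1 = 2N.  A common divisor g of n and
--     σ(n) divides σ(N) (by (1)) and 2N, hence g ∣ 1: gcd(n, σ(n)) = 1.
-- (3) For q ≥ 2, σ(q·n) ≥ 1 + q·σ(n) (the divisors q·e, e ∣ n, and 1),
--     so I(q·n) > I(n).
-- (4) If gcd(n, σ(n)) = 1 and I(d) = I(n), then σ(n)·d = σ(d)·n forces
--     n ∣ d, say d = q·n; by (3) q = 1, i.e. n is solitary.

open import Defs
open import Data.Nat using (ℕ; zero; suc; _+_; _*_; _^_; _≥_; _>_; _≤_; _<_; NonZero; z≤n; s≤s; ≢-nonZero; ≢-nonZero⁻¹; >-nonZero; >-nonZero⁻¹)
open import Data.Nat.Properties
open import Data.Nat.Divisibility
open import Data.Nat.GCD using (gcd)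
open import Data.Nat.Coprimality using (Coprime; coprime-divisor; gcd≡1⇒coprime)
open import Data.Nat.Primality using (prime[2]; prime⇒irreducible; euclidsLemma)
open import Data.Nat.ListAction using (sum)
open import Data.Nat.ListAction.Properties using (sum-++; sum-↭)
open import Data.List using (List; []; _∷_; _++_; [_]; map; upTo)
open import Data.List.Membership.Propositional using (_∈_)
open import Data.List.Membership.Propositional.Properties
  using (∈-∃++; ∈-filter⁺; ∈-filter⁻; ∈-map⁺; ∈-map⁻; ∈-upTo⁺; ∈-++⁺ˡ; ∈-++⁺ʳ; ∈-++⁻)
open import Data.List.Relation.Binary.Subset.Propositional using (_⊆_)
open import Data.List.Relation.Binary.Permutation.Propositional.Properties using (shift; ∈-resp-↭)
open import Data.List.Relation.Unary.Any using (here; there)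
import Data.List.Relation.Unary.All as All
open import Data.List.Relation.Unary.AllPairs using (_∷_)
open import Data.List.Relation.Unary.Unique.Propositional using (Unique)
import Data.List.Relation.Unary.Unique.Propositional.Properties as Unique
open import Data.Rational.Properties using (normalize-injective-≃)
open import Data.Product using (_×_; _,_)
open import Data.Sum using (inj₁; inj₂; [_,_]′)
open import Relation.Nullary using (¬_; yes; no; contradiction)
open import Relation.Binary.PropositionalEquality using (_≡_; _≢_; refl; sym; trans; cong; cong₂; subst; ≢-sym; module ≡-Reasoning)
open import Data.Nat.Solver using (module +-*-Solver)

∈-remove : ∀ {x a : ℕ} us vs → x ∈ us ++ [ a ] ++ vs → x ≢ a → x ∈ us ++ vs
∈-remove {a = a} us vs x∈ x≢a with ∈-resp-↭ (shift a us vs) x∈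
... | here x≡a = contradiction x≡a x≢a
... | there x∈us++vs = x∈us++vs

sum-mono-⊆ : ∀ {xs ys : List ℕ} → Unique xs → xs ⊆ ys → sum xs ≤ sum ys
sum-mono-⊆ {[]} _ _ = z≤n
sum-mono-⊆ {x ∷ xs} (x∉xs ∷ xs-unique) xs⊆ys with ∈-∃++ (xs⊆ys (here refl))
... | us , vs , refl = begin
  x + sum xs         ≤⟨ +-monoʳ-≤ x (sum-mono-⊆ xs-unique xs⊆us++vs) ⟩
  x + sum (us ++ vs) ≡⟨ sum-↭ (shift x us vs) ⟨
  sum (us ++ [ x ] ++ vs) ∎
  where
  open ≤-Reasoning
  xs⊆us++vs : xs ⊆ us ++ vs
  xs⊆us++vs z∈xs = ∈-remove us vs (xs⊆ys (there z∈xs)) (≢-sym (All.lookup x∉xs z∈xs))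

sum-cong-⊆⊇ : ∀ {xs ys : List ℕ} → Unique xs → Unique ys → xs ⊆ ys → ys ⊆ xs → sum xs ≡ sum ys
sum-cong-⊆⊇ xs-unique ys-unique xs⊆ys ys⊆xs =
  ≤-antisym (sum-mono-⊆ xs-unique xs⊆ys) (sum-mono-⊆ ys-unique ys⊆xs)

sum-map-* : ∀ k (xs : List ℕ) → sum (map (k *_) xs) ≡ k * sum xs
sum-map-* k [] = sym (*-zeroʳ k)
sum-map-* k (x ∷ xs) = trans (cong (k * x +_) (sum-map-* k xs)) (sym (*-distribˡ-+ k x (sum xs)))

map-*-unique : ∀ k .{{_ : NonZero k}} {xs : List ℕ} → Unique xs → Unique (map (k *_) xs)
map-*-unique k = Unique.map⁺ (λ {a} {b} → *-cancelˡ-≡ a b k)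

∈-divisors⁻ : ∀ {x n} → x ∈ divisors n → x ∣ n
∈-divisors⁻ {n = n} x∈ = let _ , x∣n = ∈-filter⁻ (_∣? n) {xs = map suc (upTo n)} x∈ in x∣n

∈-divisors⁺ : ∀ {x n} .{{_ : NonZero n}} → x ∣ n → x ∈ divisors n
∈-divisors⁺ {zero} {n} 0∣n = contradiction (0∣⇒≡0 0∣n) (≢-nonZero⁻¹ n)
∈-divisors⁺ {suc x} {n} x∣n = ∈-filter⁺ (_∣? n) (∈-map⁺ suc (∈-upTo⁺ (∣⇒≤ x∣n))) x∣n

divisors-unique : ∀ n → Unique (divisors n)
divisors-unique n = Unique.filter⁺ (_∣? n) (Unique.map⁺ suc-injective (Unique.upTo⁺ n))

Odd : ℕ → Set
Odd m = ¬ (2 ∣ m)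

gcd[2,m]≡1⇒odd : ∀ {m} → gcd 2 m ≡ 1 → Odd m
gcd[2,m]≡1⇒odd gcd≡1 2∣m = contradiction (gcd≡1⇒coprime gcd≡1 (∣-refl , 2∣m)) λ ()

odd-square : ∀ {m} → Odd m → Odd (m * m)
odd-square {m} m-odd 2∣m² = [ m-odd , m-odd ]′ (euclidsLemma m m prime[2] 2∣m²)

odd⇒coprime-2 : ∀ {x} → Odd x → Coprime x 2
odd⇒coprime-2 x-odd (i∣x , i∣2) with prime⇒irreducible prime[2] i∣2
... | inj₁ i≡1 = i≡1
... | inj₂ refl = contradiction i∣x x-odd

odd-∣-2^k* : ∀ {x m} k → Odd x → x ∣ 2 ^ k * m → x ∣ m
odd-∣-2^k* {x} {m} zero x-odd x∣ = subst (x ∣_) (*-identityˡ m) x∣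
odd-∣-2^k* {x} {m} (suc k) x-odd x∣ =
  odd-∣-2^k* k x-odd (coprime-divisor (odd⇒coprime-2 x-odd) (subst (x ∣_) (*-assoc 2 (2 ^ k) m) x∣))

module _ (m k : ℕ) .{{_ : NonZero m}} (m-odd : Odd m) where

  private
    X : ℕ
    X = 2 ^ k * m

    instance
      X≢0 : NonZero X
      X≢0 = m*n≢0 (2 ^ k) m {{m^n≢0 2 k}}

      2X≢0 : NonZero (2 * X)
      2X≢0 = m*n≢0 2 X

  -- The divisors of 2X: twice the divisors of X, and the (odd) divisors of m.
  split : List ℕ
  split = map (2 *_) (divisors X) ++ divisors m

  -- The two parts are duplicate-free, and disjoint since m is odd.
  split-unique : Unique split
  split-unique = Unique.++⁺ (map-*-unique 2 (divisors-unique X)) (divisors-unique m) disjoint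
    where
    disjoint : ∀ {v} → ¬ (v ∈ map (2 *_) (divisors X) × v ∈ divisors m)
    disjoint (v∈doubles , v∈divisors-m) with ∈-map⁻ (2 *_) v∈doubles
    ... | y , _ , refl = m-odd (∣-trans (m∣m*n y) (∈-divisors⁻ v∈divisors-m))

  -- Every element of split divides 2X, and conversely every divisor x of 2X
  -- is either even (x = 2y with y ∣ X) or odd (then x ∣ m).
  split⊆divisors : split ⊆ divisors (2 * X)
  split⊆divisors x∈ with ∈-++⁻ (map (2 *_) (divisors X)) x∈
  ... | inj₁ x∈doubles with ∈-map⁻ (2 *_) x∈doubles
  ...   | y , y∈ , refl = ∈-divisors⁺ (*-monoʳ-∣ 2 (∈-divisors⁻ {n = X} y∈))
  split⊆divisors x∈ | inj₂ x∈divisors-m =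
    ∈-divisors⁺ (∣n⇒∣m*n 2 (∣n⇒∣m*n (2 ^ k) (∈-divisors⁻ x∈divisors-m)))

  divisors⊆split : divisors (2 * X) ⊆ split
  divisors⊆split {x} x∈ with 2 ∣? x
  ... | yes (divides y refl) =
    ∈-++⁺ˡ (subst (_∈ map (2 *_) (divisors X)) (*-comm 2 y) (∈-map⁺ (2 *_) (∈-divisors⁺ y∣X)))
    where
    y∣X : y ∣ X
    y∣X = *-cancelˡ-∣ 2 (subst (_∣ 2 * X) (*-comm y 2) (∈-divisors⁻ x∈))
  ... | no x-odd = ∈-++⁺ʳ (map (2 *_) (divisors X)) (∈-divisors⁺ (odd-∣-2^k* (suc k) x-odd x∣))
    where
    x∣ : x ∣ 2 ^ suc k * m
    x∣ = subst (x ∣_) (sym (*-assoc 2 (2 ^ k) m)) (∈-divisors⁻ x∈)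

  σ-double : σ (2 * (2 ^ k * m)) ≡ 2 * σ (2 ^ k * m) + σ m
  σ-double = begin
    σ (2 * X)                                     ≡⟨ sum-cong-⊆⊇ (divisors-unique (2 * X)) split-unique divisors⊆split split⊆divisors ⟩
    sum split                                     ≡⟨ sum-++ (map (2 *_) (divisors X)) (divisors m) ⟩
    sum (map (2 *_) (divisors X)) + σ m           ≡⟨ cong (_+ σ m) (sum-map-* 2 (divisors X)) ⟩
    2 * σ X + σ m                                 ∎
    where open ≡-Reasoning

-- σ(2ᵏ·m) = (2ᵏ⁺¹ - 1)·σ(m) for odd m, in additive form.
σ-2^k* : ∀ m .{{_ : NonZero m}} → Odd m → ∀ k → σ (2 ^ k * m) + σ m ≡ 2 ^ suc k * σ m
σ-2^k* m m-odd zero = cong₂ _+_ (cong σ (*-identityˡ m)) (sym (+-identityʳ (σ m)))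
σ-2^k* m m-odd (suc k) = begin
  σ (2 ^ suc k * m) + σ m           ≡⟨ cong (λ t → σ t + σ m) (*-assoc 2 (2 ^ k) m) ⟩
  σ (2 * (2 ^ k * m)) + σ m         ≡⟨ cong (_+ σ m) (σ-double m k m-odd) ⟩
  (2 * σ (2 ^ k * m) + σ m) + σ m   ≡⟨ regroup (σ (2 ^ k * m)) (σ m) ⟩
  2 * (σ (2 ^ k * m) + σ m)         ≡⟨ cong (2 *_) (σ-2^k* m m-odd k) ⟩
  2 * (2 ^ suc k * σ m)             ≡⟨ *-assoc 2 (2 ^ suc k) (σ m) ⟨
  2 ^ suc (suc k) * σ m             ∎
  where
  open ≡-Reasoning
  open +-*-Solver
  regroup : ∀ a s → (2 * a + s) + s ≡ 2 * (a + s)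
  regroup = solve 2 (λ a s → (con 2 :* a :+ s) :+ s := con 2 :* (a :+ s)) refl

-- If 2ʳ·n is almost perfect (n odd) then gcd(n, σ(n)) = 1: a common
-- divisor divides σ(2ʳ·n) = 2ʳ⁺¹σ(n) - σ(n) and 2·2ʳ·n = σ(2ʳ·n) + 1.
almostPerfect⇒coprime : ∀ r n .{{_ : NonZero n}} → Odd n → AlmostPerfect (2 ^ r * n) → Coprime n (σ n)
almostPerfect⇒coprime r n n-odd (N≥1 , σN≡2N-1) {g} (g∣n , g∣σn) = ∣1⇒≡1 g∣1
  where
  N = 2 ^ r * n
  σN+1≡2N : σ N + 1 ≡ 2 * N
  σN+1≡2N = trans (cong (_+ 1) σN≡2N-1) (m∸n+n≡m (≤-trans N≥1 (m≤m+n N (N + 0))))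
  g∣σN : g ∣ σ N
  g∣σN = ∣m+n∣n⇒∣m (subst (g ∣_) (sym (σ-2^k* n n-odd r)) (∣n⇒∣m*n (2 ^ suc r) g∣σn)) g∣σn
    where
    ∣m+n∣n⇒∣m : ∀ {a b} → g ∣ a + b → g ∣ b → g ∣ a
    ∣m+n∣n⇒∣m {a} {b} g∣a+b = ∣m+n∣m⇒∣n (subst (g ∣_) (+-comm a b) g∣a+b)
  g∣1 : g ∣ 1
  g∣1 = ∣m+n∣m⇒∣n (subst (g ∣_) (sym σN+1≡2N) (∣n⇒∣m*n 2 (∣n⇒∣m*n (2 ^ r) g∣n))) g∣σN

-- σ(q·n) ≥ 1 + q·σ(n) for q ≥ 2: the divisors q·e (e ∣ n) and 1 are distinct.
σ-multiple-lower-bound : ∀ q n .{{_ : NonZero n}} → 2 ≤ q → 1 + q * σ n ≤ σ (q * n)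
σ-multiple-lower-bound q n 2≤q = begin
  1 + q * σ n                          ≡⟨ cong suc (sum-map-* q (divisors n)) ⟨
  sum (1 ∷ map (q *_) (divisors n))    ≤⟨ sum-mono-⊆ unique ⊆divisors ⟩
  σ (q * n)                            ∎
  where
  open ≤-Reasoning
  instance
    q≢0 : NonZero q
    q≢0 = >-nonZero (≤-trans (s≤s z≤n) 2≤q)
    qn≢0 : NonZero (q * n)
    qn≢0 = m*n≢0 q n
  1≢q* : ∀ {v} → v ∈ map (q *_) (divisors n) → 1 ≢ v
  1≢q* v∈ 1≡v with ∈-map⁻ (q *_) v∈
  ... | e , _ , refl = contradiction (∣1⇒≡1 (divides e (trans 1≡v (*-comm q e)))) λ q≡1 → <⇒≢ 2≤q (sym q≡1)
  unique : Unique (1 ∷ map (q *_) (divisors n))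
  unique = All.tabulate 1≢q* ∷ map-*-unique q (divisors-unique n)
  ⊆divisors : 1 ∷ map (q *_) (divisors n) ⊆ divisors (q * n)
  ⊆divisors (here refl) = ∈-divisors⁺ (1∣ (q * n))
  ⊆divisors (there v∈) with ∈-map⁻ (q *_) v∈
  ... | e , e∈ , refl = ∈-divisors⁺ (*-monoʳ-∣ q (∈-divisors⁻ e∈))

-- I(q·n) > I(n) for q ≥ 2, in cross-multiplied form.
abundancy-increases : ∀ q n .{{_ : NonZero n}} → 2 ≤ q → σ n * (q * n) < σ (q * n) * n
abundancy-increases q n 2≤q = begin-strict
  σ n * (q * n)      ≡⟨ *-assoc (σ n) q n ⟨
  σ n * q * n        ≡⟨ cong (_* n) (*-comm (σ n) q) ⟩
  q * σ n * n        <⟨ m<n+m (q * σ n * n) (>-nonZero⁻¹ n) ⟩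
  (1 + q * σ n) * n  ≤⟨ *-monoˡ-≤ n (σ-multiple-lower-bound q n 2≤q) ⟩
  σ (q * n) * n      ∎
  where open ≤-Reasoning

I≡⇒cross : ∀ n d .{{_ : NonZero n}} .{{_ : NonZero d}} → I n ≡ I d → σ n * d ≡ σ d * n
I≡⇒cross n d = normalize-injective-≃ (σ n) (σ d) n d
  {{≢-nonZero (≢-nonZero⁻¹ n)}} {{≢-nonZero (≢-nonZero⁻¹ d)}}

-- From σ(n)·d = σ(d)·n and gcd(n, σ(n)) = 1 we get n ∣ d; a proper
-- multiple d = q·n (q ≥ 2) has a strictly larger abundancy index.
coprime⇒solitary : ∀ n .{{_ : NonZero n}} → Coprime n (σ n) → Solitary n
coprime⇒solitary n coprime d I[n]≡I[d] = same-abundancy⇒≡ d (I≡⇒cross n d I[n]≡I[d])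
  where
  same-abundancy⇒≡ : ∀ d .{{_ : NonZero d}} → σ n * d ≡ σ d * n → d ≡ n
  same-abundancy⇒≡ d σn*d≡σd*n with coprime-divisor coprime (divides (σ d) σn*d≡σd*n)
  ... | divides zero d≡0 = contradiction d≡0 (≢-nonZero⁻¹ d)
  ... | divides (suc zero) d≡1*n = trans d≡1*n (*-identityˡ n)
  ... | divides q@(suc (suc _)) refl =
    contradiction σn*d≡σd*n (<⇒≢ (abundancy-increases q n (s≤s (s≤s z≤n))))

-- The theorem: if 2ʳ·b² is almost perfect with b odd, then b² is solitary.
lemma3 : (r b : ℕ) → r ≥ 1 → b > 1 → gcd 2 b ≡ 1
           → AlmostPerfect (2 ^ r * (b * b))
           → .{{_ : NonZero (b * b)}} → Solitary (b * b)
lemma3 r b _ _ gcd[2,b]≡1 almostPerfect =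
  coprime⇒solitary (b * b) (almostPerfect⇒coprime r (b * b) b²-odd almostPerfect)
  where
  b²-odd : Odd (b * b)
  b²-odd = odd-square {b} (gcd[2,m]≡1⇒odd gcd[2,b]≡1)
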